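{- Let $m\ge 2$, $e=\binom m2$, and let $D^{(1)},\dots,D^{(s)}\in\mathbb{R}^e/\mathbb{R}\mathbf{1}$ be ultrametrics, viewed as equidistant rooted trees on leaf set $[m]$. Let $\mathcal P=\mathrm{tconv}(D^{(1)},\dots,D^{(s)})$. Then the origin $\mathbf 0$ lies in $\mathcal P$ if and only if for each pair of leaves $i,j$ there exists some $k\in\{1,\dots,s\}$ such that the path between $i$ and $j$ in the tree $D^{(k)}$ passes through the root of $D^{(k)}$.
   Context: Max-plus tropical arithmetic: $a\oplus b=\max\{a,b\}$, $a\odot b=a+b$, applied coordinatewise to vectors ($a\odot v=(a+v_1,\dots,a+v_e)$). $\mathbb{R}^e/\mathbb{R}\mathbf{1}$ is the quotient by the all-ones vector; coordinates are indexed by pairs $\{i,j\}\subseteq[m]$. $\mathrm{tconv}(V)$ is the set of tropical linear combinations $a_1\odot v_1\oplus\cdots\oplus a_r\odot v_r$, $v_i\in V$, $a_i\in\mathbb{R}$. An ultrametric is a metric $d$ on $[m]$ with $d(i,k)\le\max(d(i,j),d(j,k))$; ultrametrics are exactly the tree metrics of equidistant trees (rooted trees where every root-to-leaf path has the same length), and a point of $\mathbb{R}^e/\mathbb{R}\mathbf{1}$ is an ultrametric if it is the class of one. In an equidistant tree with ultrametric $D$, the path between leaves $i,j$ passes through the root exactly when $D_{ij}$ is the largest coordinate of $D$. -}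

module Defs where

open import Level using (Level; _⊔_) renaming (suc to lsuc)
open import Data.Nat using (ℕ)
open import Data.Fin using (Fin; _<_)
open import Data.Fin.Properties using (<-cmp)
open import Data.Product using (Σ; ∃; _×_; _,_)
open import Data.Sum using (_⊎_)
open import Relation.Nullary using (¬_)
open import Relation.Binary using (Rel; Tri; tri<; tri≈; tri>)
open import Relation.Binary.Structures using (IsTotalOrder)
open import Algebra.Bundles using (AbelianGroup)

-- A totally ordered abelian group (written additively).  The real numbers
-- (ℝ, +, ≤) are an instance; the theorem is stated for every such group.
record OrdAbGroup (c ℓ₁ ℓ₂ : Level) : Set (lsuc (c ⊔ ℓ₁ ⊔ ℓ₂)) where
  field
    abGroup : AbelianGroup c ℓ₁
  open AbelianGroup abGroup public
    renaming (_∙_ to _+_; ε to 0#; _⁻¹ to -_)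
  field
    _≤_          : Rel Carrier ℓ₂
    isTotalOrder : IsTotalOrder _≈_ _≤_
    +-monoʳ-≤    : ∀ {x y} z → x ≤ y → (z + x) ≤ (z + y)

  _<ᵍ_ : Rel Carrier (ℓ₁ ⊔ ℓ₂)
  x <ᵍ y = (x ≤ y) × ¬ (x ≈ y)

module _ {c ℓ₁ ℓ₂ : Level} (G : OrdAbGroup c ℓ₁ ℓ₂) where
  open OrdAbGroup G

  -- A vector in G^e, e = m choose 2, with coordinates indexed by the
  -- pairs {i,j} ⊆ [m], written as i < j.
  Point : ℕ → Set c
  Point m = (i j : Fin m) → i < j → Carrier

  shift : ∀ {m} → Carrier → Point m → Point m
  shift a v i j p = a + v i j p

  asMap : ∀ {m} → Point m → Fin m → Fin m → Carrier
  asMap v i j with <-cmp i j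
  ... | tri< p _ _ = v i j p
  ... | tri≈ _ _ _ = 0#
  ... | tri> _ _ p = v j i p

  -- d is an ultrametric on [m]: a metric with d(i,k) ≤ max(d(i,j),d(j,k)).
  -- (Symmetry and d(i,i)=0 are built into asMap; the triangle inequality
  -- follows from the ultrametric inequality and positivity, but we include
  -- positivity and the ultrametric inequality exactly.)
  IsUltrametric : ∀ {m} → Point m → Set (ℓ₁ ⊔ ℓ₂)
  IsUltrametric {m} v =
    (∀ i j → (p : i < j) → 0# <ᵍ v i j p) ×
    (∀ i j k → (asMap v i k ≤ asMap v i j) ⊎ (asMap v i k ≤ asMap v j k))

  -- A point of G^e / G·1 is an ultrametric if it is the class of one:
  -- some representative v + a·1 is an ultrametric.
  IsUltrametricClass : ∀ {m} → Point m → Set (c ⊔ ℓ₁ ⊔ ℓ₂)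
  IsUltrametricClass v = ∃ λ a → IsUltrametric (shift a v)

  IsMax : ∀ {s} → (Fin s → Carrier) → Carrier → Set (ℓ₁ ⊔ ℓ₂)
  IsMax f x = (∀ k → f k ≤ x) × ∃ λ k → f k ≈ x

  -- The origin 0 lies in tconv(D(1),...,D(s)) ⊆ G^e / G·1:  there are
  -- scalars a_k with ⊕_k (a_k ⊙ D(k)) equal to 0 modulo G·1, i.e. equal
  -- to λ·1 for some λ.
  OriginInTconv : ∀ {m s} → (Fin s → Point m) → Set (c ⊔ ℓ₁ ⊔ ℓ₂)
  OriginInTconv {m} {s} D =
    ∃ λ (a : Fin s → Carrier) → ∃ λ (l : Carrier) →
      ∀ i j (p : i < j) → IsMax (λ k → a k + D k i j p) l

  -- In the equidistant tree of the ultrametric D, the path between leaves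
  -- i and j passes through the root iff D_ij is a largest coordinate of D
  -- (this is the characterization fixed in the paper's context).
  PathThroughRoot : ∀ {m} → Point m → (i j : Fin m) → i < j → Set ℓ₂
  PathThroughRoot {m} D i j p = ∀ i' j' (p' : i' < j') → D i' j' p' ≤ D i j p

module Submission where

-- (⇒) If ⊕ₖ (aₖ ⊙ D(k)) = λ·1, then for the pair {i,j} the maximum λ is
--     attained by some k, so aₖ + D(k)ᵢⱼ ≥ aₖ + D(k)ᵢ'ⱼ' for every other pair;
--     cancelling aₖ shows that D(k)ᵢⱼ is a largest coordinate of D(k).
-- (⇐) Let Mₖ be the largest coordinate of D(k) and take aₖ = -Mₖ.  Every
--     coordinate of -Mₖ ⊙ D(k) is ≤ 0, and for each pair some k attains
--     D(k)ᵢⱼ = Mₖ, so the tropical sum is the zero vector.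
--
-- Neither direction uses that the D(k) are ultrametrics: the ultrametric
-- hypothesis only supplies the tree reading of "largest coordinate".

open import Defs
open import Level using (Level; _⊔_)
open import Data.Nat using (ℕ; zero; suc; s≤s; z≤n) renaming (_≤_ to _≤ℕ_)
open import Data.Fin using (Fin; _<_; _<?_) renaming (zero to fzero; suc to fsuc)
open import Data.Fin.Properties using (<-irrelevant)
open import Data.Product using (Σ; ∃; _,_; proj₁; proj₂; uncurry)
open import Data.Sum using (inj₁; inj₂)
open import Data.Empty using (⊥-elim)
open import Function.Bundles using (_⇔_; mk⇔)
open import Relation.Nullary using (yes; no)
open import Relation.Binary.PropositionalEquality using (subst)
open import Relation.Binary.Structures using (IsTotalOrder)
import Algebra.Properties.AbelianGroup as AbelianGroupProperties

module TropicalOrigin {c ℓ₁ ℓ₂ : Level} (G : OrdAbGroup c ℓ₁ ℓ₂) where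
  open OrdAbGroup G
  open IsTotalOrder isTotalOrder
    using (total; antisym; ≲-respˡ-≈; ≲-respʳ-≈)
    renaming (trans to ≤-trans; reflexive to ≤-reflexive)
  open AbelianGroupProperties abGroup using (\\-leftDividesʳ)

  +-cancelˡ-≤ : ∀ a {x y} → (a + x) ≤ (a + y) → x ≤ y
  +-cancelˡ-≤ a {x} {y} a+x≤a+y =
    ≲-respʳ-≈ (\\-leftDividesʳ a y)
      (≲-respˡ-≈ (\\-leftDividesʳ a x) (+-monoʳ-≤ (- a) a+x≤a+y))

  record Maximum {I : Set} (f : I → Carrier) : Set (c ⊔ ℓ₁ ⊔ ℓ₂) where
    constructor maximum
    field
      value    : Carrier
      bounds   : ∀ i → f i ≤ value
      argmax   : I
      attained : f argmax ≈ value
  open Maximum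

  finiteMax : ∀ n (f : Fin (suc n) → Carrier) → Maximum f
  finiteMax zero f = maximum (f fzero) (λ { fzero → ≤-reflexive refl }) fzero refl
  finiteMax (suc n) f with finiteMax n (λ i → f (fsuc i))
  ... | maximum M bound i attainedᵢ with total (f fzero) M
  ...   | inj₁ f₀≤M =
          maximum M (λ { fzero → f₀≤M ; (fsuc k) → bound k }) (fsuc i) attainedᵢ
  ...   | inj₂ M≤f₀ =
          maximum (f fzero) (λ { fzero → ≤-reflexive refl ; (fsuc k) → ≤-trans (bound k) M≤f₀ })
                  fzero refl

  gridMax : ∀ n (f : Fin (suc n) → Fin (suc n) → Carrier) → Maximum (uncurry f)
  gridMax n f = maximum (value rows) bound (i , argmax (row i))
                        (trans (attained (row i)) (attained rows))
    where
    row : ∀ i → Maximum (f i)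
    row i = finiteMax n (f i)
    rows : Maximum (λ i → value (row i))
    rows = finiteMax n (λ i → value (row i))
    bound : ∀ ij → uncurry f ij ≤ value rows
    bound (i , j) = ≤-trans (bounds (row i) j) (bounds rows i)
    i : Fin (suc n)
    i = argmax rows

  sameValues-max : {I J : Set} {f : I → Carrier} {g : J → Carrier} →
    (∀ j → ∃ λ i → g j ≈ f i) → (∀ i → ∃ λ j → f i ≈ g j) →
    Maximum g → Maximum f
  sameValues-max g⊆f f⊆g (maximum M bound j gj≈M) =
    maximum M (λ i → ≲-respˡ-≈ (sym (proj₂ (f⊆g i))) (bound (proj₁ (f⊆g i))))
            (proj₁ (g⊆f j)) (trans (sym (proj₂ (g⊆f j))) gj≈M)

  Coordinate : ℕ → Set
  Coordinate m = Σ (Fin m) λ i → Σ (Fin m) λ j → i < j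

  coordinate : ∀ {m} → Point G m → Coordinate m → Carrier
  coordinate v (i , j , p) = v i j p

  -- The point is padded to a
  -- full m × m grid by repeating the coordinate {0,1} off the pairs i < j;
  -- the grid and the point then have the same values.
  pointMax : ∀ n (v : Point G (suc (suc n))) → Maximum (coordinate v)
  pointMax n v =
    sameValues-max (uncurry padded⊆v) v⊆padded (gridMax (suc n) padded)
    where
    pair₀₁ : Coordinate (suc (suc n))
    pair₀₁ = fzero , fsuc fzero , s≤s z≤n
    padded : Fin (suc (suc n)) → Fin (suc (suc n)) → Carrier
    padded i j with i <? j
    ... | yes p = v i j p
    ... | no _  = coordinate v pair₀₁
    padded⊆v : ∀ i j → ∃ λ pair → padded i j ≈ coordinate v pair
    padded⊆v i j with i <? j
    ... | yes p = (i , j , p) , refl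
    ... | no _  = pair₀₁ , refl
    v⊆padded : ∀ pair → ∃ λ ij → coordinate v pair ≈ uncurry padded ij
    v⊆padded (i , j , p) = (i , j) , padding-agrees
      where
      padding-agrees : v i j p ≈ padded i j
      padding-agrees with i <? j
      ... | yes q  = subst (λ r → v i j p ≈ v i j r) (<-irrelevant p q) refl
      ... | no i≮j = ⊥-elim (i≮j p)

  origin⇒rootPaths : ∀ {m s} (D : Fin s → Point G m) → OriginInTconv G D →
    ∀ i j (p : i < j) → ∃ λ k → PathThroughRoot G (D k) i j p
  origin⇒rootPaths D (a , l , isMax) i j p with isMax i j p
  ... | _ , k , akDij≈l = k , λ i' j' p' →
        +-cancelˡ-≤ (a k) (≲-respʳ-≈ (sym akDij≈l) (proj₁ (isMax i' j' p') k))

  throughRoot⇒max : ∀ {m} {v : Point G m} (max : Maximum (coordinate v)) →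
    ∀ {i j} {p : i < j} → PathThroughRoot G v i j p → v i j p ≈ value max
  throughRoot⇒max (maximum M bound (i' , j' , p') vi'j'≈M) largest =
    antisym (bound (_ , _ , _)) (≲-respˡ-≈ vi'j'≈M (largest i' j' p'))

  rootPaths⇒origin : ∀ {m s} (D : Fin s → Point G m) →
    (∀ k → Maximum (coordinate (D k))) →
    (∀ i j (p : i < j) → ∃ λ k → PathThroughRoot G (D k) i j p) →
    OriginInTconv G D
  rootPaths⇒origin {s = s} D maxima rootPaths = (λ k → - max k) , 0# , isZero
    where
    max : Fin s → Carrier
    max k = value (maxima k)
    isZero : ∀ i j (p : i < j) → IsMax G (λ k → - max k + D k i j p) 0#
    isZero i j p with rootPaths i j p
    ... | k , throughRoot =
      (λ k' → ≲-respʳ-≈ (inverseˡ (max k'))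
                (+-monoʳ-≤ (- max k') (bounds (maxima k') (i , j , p))))
      , k , trans (∙-cong refl (throughRoot⇒max (maxima k) throughRoot))
                  (inverseˡ (max k))

open TropicalOrigin using (pointMax; origin⇒rootPaths; rootPaths⇒origin)

mainTheorem2 : ∀ {c ℓ₁ ℓ₂ : Level} (G : OrdAbGroup c ℓ₁ ℓ₂)
    (m : ℕ) → 2 ≤ℕ m → (s : ℕ) (D : Fin s → Point G m) →
    (∀ k → IsUltrametricClass G (D k)) →
    (OriginInTconv G D ⇔
      (∀ (i j : Fin m) (p : i < j) → ∃ λ k → PathThroughRoot G (D k) i j p))
mainTheorem2 G (suc (suc n)) (s≤s (s≤s z≤n)) s D _ =
  mk⇔ (origin⇒rootPaths G D)
      (rootPaths⇒origin G D (λ k → pointMax G n (D k)))
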